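{- Let $p\ge 1$ be an integer and $n=2^p$. For integers $a\in\{0,\dots,p-1\}$ and $k\in\{1,\dots,2^{p-a-1}\}$ define the vector $B^a_k\in\mathbb{R}^n$ by $$B^a_k(j)=\begin{cases}1 & (2k-2)2^{a}< j \leq (2k-1)2^a,\\ -1 & (2k-1)2^a < j \leq 2k\,2^a,\\ 0 & \text{otherwise},\end{cases}\qquad j=1,\dots,n,$$ and let $B^p_1\in\mathbb{R}^n$ be the all-ones vector. Let $s,t\in\mathbb{N}$ with $s<t$, and let $R_{s,t}\in\mathbb{R}^n$ be given by $R_{s,t}(j)=1$ if $s<j\le t$ and $R_{s,t}(j)=0$ otherwise. Then the number of vectors $B^a_k$ in the family $\{B^a_k : 0\le a\le p-1,\ 1\le k\le 2^{p-a-1}\}\cup\{B^p_1\}$ whose inner product with $R_{s,t}$ is nonzero, i.e. with $R_{s,t}\star B^a_k=\sum_{j=1}^n R_{s,t}(j)B^a_k(j)\neq 0$, is at most $2\log_2(n)=2p$.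
   Context: Here $\log$ is the base-2 logarithm, so $\log(n)=p$. The inner product $\star$ on $\mathbb{R}^n$ is the standard dot product. -}

module Defs where

open import Data.Nat as ℕ using (ℕ; zero; suc; _∸_; _^_; _<ᵇ_; _≤ᵇ_)
open import Data.Bool using (Bool; true; false; if_then_else_; _∧_)
open import Data.Integer as ℤ using (ℤ; +_; -[1+_])
open import Data.List using (List; []; _∷_; map; concatMap; upTo; filter; length; foldr; _++_)
open import Data.Product using (_×_; _,_; proj₁; proj₂)
open import Relation.Nullary.Decidable using (¬?)

-- Vectors in ℝ^n with entries in {-1,0,1} are represented as integer-valued
-- functions on the index set j = 1..n (here given as ℕ → ℤ, only j ∈ 1..n used).
RVec : Set
RVec = ℕ → ℤ

between : ℕ → ℕ → ℕ → Bool
between lo hi j = (lo <ᵇ j) ∧ (j ≤ᵇ hi)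

Bvec : ℕ → ℕ → RVec
Bvec a k j =
  if between ((2 ℕ.* k ∸ 2) ℕ.* 2 ^ a) ((2 ℕ.* k ∸ 1) ℕ.* 2 ^ a) j then + 1
  else if between ((2 ℕ.* k ∸ 1) ℕ.* 2 ^ a) (2 ℕ.* k ℕ.* 2 ^ a) j then -[1+ 0 ]
  else + 0

ones : RVec
ones _ = + 1

Rvec : ℕ → ℕ → RVec
Rvec s t j = if between s t j then + 1 else + 0

indices : ℕ → List ℕ
indices n = map suc (upTo n)

dot : (n : ℕ) → RVec → RVec → ℤ
dot n u v = foldr ℤ._+_ (+ 0) (map (λ j → u j ℤ.* v j) (indices n))

family : (p : ℕ) → List RVec
family p =
  concatMap (λ a → map (λ k → Bvec a k) (map suc (upTo (2 ^ (p ∸ a ∸ 1))))) (upTo p)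
  ++ (ones ∷ [])

countNonzero : (p s t : ℕ) → ℕ
countNonzero p s t =
  length (filter (λ B → ¬? (dot (2 ^ p) (Rvec s t) B ℤ.≟ + 0)) (family p))

module Submission where

-- The family {B^a_k} ∪ {B^p_1} is the Haar system on {1,…,2^p}.  On level a
-- the vectors B^a_1, B^a_2, … are "Haar blocks": +1 on the first half and −1 on
-- the second half of the consecutive intervals (lo, lo + 2^(a+1)], so each of
-- them is supported on its interval and has total sum zero.
--
-- 1. Finite sums Σ n f = Σ_{i<n} f i, and the dot product as such a sum.
-- 2. Orthogonality: a zero-sum vector supported on (lo, hi] is orthogonal to
--    the indicator R_{s,t} unless s or t lies strictly inside (lo, hi).
-- 3. Haar blocks satisfy these hypotheses, and B^a_{k+1} is the block at
--    lo = k·2^(a+1).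
-- 4. Counting: scanning the blocks of a level from left to right, a block can
--    only be counted when an endpoint s or t lies inside it, so the number of
--    counted blocks among the first K is at most the number of endpoints below
--    K·2^(a+1); hence each level contributes at most 2.
-- 5. The theorem: the levels a < p−1 contribute ≤ 2 each, the top level
--    a = p−1 consists of a single vector, and B^p_1 adds one more: 2(p−1)+1+1.
--    The argument never uses s < t (for s ≥ t, R_{s,t} = 0 and the bound is
--    trivial), only p ≥ 1.

open import Defs
open import Data.Nat as ℕ using (ℕ; _≤_; _<_; _*_; zero; suc; _+_; _∸_; _^_; _<ᵇ_; _≤ᵇ_; z≤n; s≤s; _<?_)
open import Data.Nat.Properties
open import Data.Nat.Solver using (module +-*-Solver)
open import Data.Integer as ℤ using (ℤ; +_; -[1+_])
import Data.Integer.Properties as ℤP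
open import Algebra.Properties.CommutativeSemigroup ℤP.+-commutativeSemigroup using (interchange)
open import Data.Bool using (true; false; if_then_else_)
open import Data.List using (List; []; _∷_; map; concatMap; upTo; applyUpTo; filter; length; foldr; _++_)
open import Data.List.Properties
  using (map-++; concatMap-++; applyUpTo-∷ʳ; ++-identityʳ; length-++; length-upTo;
         filter-++; filter-accept; filter-reject; length-filter)
open import Data.List.Membership.Propositional using (_∈_)
open import Data.List.Membership.Propositional.Properties using (∈-upTo⁻)
open import Data.List.Relation.Unary.Any using (here; there)
open import Data.Sum using (_⊎_; inj₁; inj₂)
open import Data.Product using (_×_; _,_)
open import Relation.Nullary using (¬_; Dec; yes; no; contradiction)
open import Relation.Nullary.Decidable using (¬?; _×-dec_)
open import Relation.Nullary.Reflects using (ofʸ; ofⁿ)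
open import Relation.Unary using (Decidable)
open import Relation.Binary.PropositionalEquality

open +-*-Solver using (solve; _:=_; _:+_; _:*_; con)

Σ : ℕ → (ℕ → ℤ) → ℤ
Σ zero    f = + 0
Σ (suc n) f = f 0 ℤ.+ Σ n (λ i → f (suc i))

Σ-cong : ∀ n (f g : ℕ → ℤ) → (∀ i → i < n → f i ≡ g i) → Σ n f ≡ Σ n g
Σ-cong zero    f g f≗g = refl
Σ-cong (suc n) f g f≗g =
  cong₂ ℤ._+_ (f≗g 0 (s≤s z≤n)) (Σ-cong n _ _ (λ i i<n → f≗g (suc i) (s≤s i<n)))

Σ-zero : ∀ n (f : ℕ → ℤ) → (∀ i → i < n → f i ≡ + 0) → Σ n f ≡ + 0
Σ-zero zero    f f≗0 = refl
Σ-zero (suc n) f f≗0 =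
  cong₂ ℤ._+_ (f≗0 0 (s≤s z≤n)) (Σ-zero n _ (λ i i<n → f≗0 (suc i) (s≤s i<n)))

Σ-split : ∀ m r (f : ℕ → ℤ) → Σ (m + r) f ≡ Σ m f ℤ.+ Σ r (λ i → f (m + i))
Σ-split zero    r f = sym (ℤP.+-identityˡ _)
Σ-split (suc m) r f =
  trans (cong (λ x → f 0 ℤ.+ x) (Σ-split m r (λ i → f (suc i)))) (sym (ℤP.+-assoc (f 0) _ _))

Σ-+ : ∀ n (f g : ℕ → ℤ) → Σ n f ℤ.+ Σ n g ≡ Σ n (λ i → f i ℤ.+ g i)
Σ-+ zero    f g = refl
Σ-+ (suc n) f g =
  trans (interchange (f 0) (Σ n (λ i → f (suc i))) (g 0) (Σ n (λ i → g (suc i))))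
        (cong (λ x → f 0 ℤ.+ g 0 ℤ.+ x) (Σ-+ n (λ i → f (suc i)) (λ i → g (suc i))))

dot-fold : ∀ n (h : ℕ → ℤ) (f : ℕ → ℕ) →
  foldr ℤ._+_ (+ 0) (map h (map suc (applyUpTo f n))) ≡ Σ n (λ i → h (suc (f i)))
dot-fold zero    h f = refl
dot-fold (suc n) h f = cong (λ x → h (suc (f 0)) ℤ.+ x) (dot-fold n h (λ i → f (suc i)))

dot-as-Σ : ∀ n (u v : RVec) → dot n u v ≡ Σ n (λ i → u (suc i) ℤ.* v (suc i))
dot-as-Σ n u v = dot-fold n (λ j → u j ℤ.* v j) (λ i → i)

total : ℕ → RVec → ℤ
total n v = Σ n (λ i → v (suc i))

<ᵇ-true : ∀ {m n} → m < n → (m <ᵇ n) ≡ true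
<ᵇ-true {m} {n} m<n with m <ᵇ n | <ᵇ-reflects-< m n
... | true  | _        = refl
... | false | ofⁿ m≮n = contradiction m<n m≮n

<ᵇ-false : ∀ {m n} → n ≤ m → (m <ᵇ n) ≡ false
<ᵇ-false {m} {n} n≤m with m <ᵇ n | <ᵇ-reflects-< m n
... | false | _        = refl
... | true  | ofʸ m<n = contradiction m<n (≤⇒≯ n≤m)

≤ᵇ-true : ∀ {m n} → m ≤ n → (m ≤ᵇ n) ≡ true
≤ᵇ-true {m} {n} m≤n with m ≤ᵇ n | ≤ᵇ-reflects-≤ m n
... | true  | _        = refl
... | false | ofⁿ m≰n = contradiction m≤n m≰n

≤ᵇ-false : ∀ {m n} → n < m → (m ≤ᵇ n) ≡ false
≤ᵇ-false {m} {n} n<m with m ≤ᵇ n | ≤ᵇ-reflects-≤ m n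
... | false | _        = refl
... | true  | ofʸ m≤n = contradiction m≤n (<⇒≱ n<m)

between-inside : ∀ {lo hi j} → lo < j → j ≤ hi → between lo hi j ≡ true
between-inside lo<j j≤hi rewrite <ᵇ-true lo<j | ≤ᵇ-true j≤hi = refl

between-below : ∀ {lo hi j} → j ≤ lo → between lo hi j ≡ false
between-below j≤lo rewrite <ᵇ-false j≤lo = refl

between-above : ∀ {lo hi j} → hi < j → between lo hi j ≡ false
between-above {lo} {hi} {j} hi<j rewrite ≤ᵇ-false hi<j with lo <ᵇ j
... | true  = refl
... | false = refl

Rvec-inside : ∀ {s t j} → s < j → j ≤ t → Rvec s t j ≡ + 1
Rvec-inside s<j j≤t rewrite between-inside s<j j≤t = refl

Rvec-below : ∀ {s t j} → j ≤ s → Rvec s t j ≡ + 0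
Rvec-below {t = t} j≤s rewrite between-below {hi = t} j≤s = refl

Rvec-above : ∀ {s t j} → t < j → Rvec s t j ≡ + 0
Rvec-above {s} t<j rewrite between-above {lo = s} t<j = refl

Inside : ℕ → ℕ → ℕ → Set
Inside lo hi x = lo < x × x < hi

inside? : ∀ lo hi x → Dec (Inside lo hi x)
inside? lo hi x = (lo <? x) ×-dec (x <? hi)

outside : ∀ {lo hi x} → ¬ Inside lo hi x → x ≤ lo ⊎ hi ≤ x
outside {lo} {hi} {x} x∉ with lo <? x
... | yes lo<x = inj₂ (≮⇒≥ (λ x<hi → x∉ (lo<x , x<hi)))
... | no  lo≮x = inj₁ (≮⇒≥ lo≮x)

-- If v vanishes outside (lo, hi] and sums to zero, then R_{s,t} ⋆ v = 0
-- unless s or t cuts (lo, hi): either R_{s,t} and v have disjoint supports,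
-- or R_{s,t} is 1 on the whole support of v.
interval-orthogonal : ∀ n s t lo hi (v : RVec) →
  (∀ {j} → j ≤ lo → v j ≡ + 0) → (∀ {j} → hi < j → v j ≡ + 0) → total n v ≡ + 0 →
  ¬ Inside lo hi s → ¬ Inside lo hi t → dot n (Rvec s t) v ≡ + 0
interval-orthogonal n s t lo hi v v-below v-above v-total s∉ t∉ =
  trans (dot-as-Σ n (Rvec s t) v) (by-position (outside s∉) (outside t∉))
  where
  product : ℕ → ℤ
  product i = Rvec s t (suc i) ℤ.* v (suc i)

  R-zero : ∀ j → Rvec s t j ≡ + 0 → Rvec s t j ℤ.* v j ≡ + 0
  R-zero j R≡0 = cong (ℤ._* v j) R≡0

  v-zero : ∀ j → v j ≡ + 0 → Rvec s t j ℤ.* v j ≡ + 0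
  v-zero j v≡0 = trans (cong (Rvec s t j ℤ.*_) v≡0) (ℤP.*-zeroʳ (Rvec s t j))

  R-covers : s ≤ lo → hi ≤ t → ∀ j → Rvec s t j ℤ.* v j ≡ v j
  R-covers s≤lo hi≤t j with j ℕ.≤? lo | hi <? j
  ... | yes j≤lo | _ = trans (v-zero j (v-below j≤lo)) (sym (v-below j≤lo))
  ... | no  _    | yes hi<j = trans (v-zero j (v-above hi<j)) (sym (v-above hi<j))
  ... | no  j≰lo | no  hi≮j =
    trans (cong (ℤ._* v j) (Rvec-inside (≤-<-trans s≤lo (≰⇒> j≰lo)) (≤-trans (≮⇒≥ hi≮j) hi≤t)))
          (ℤP.*-identityˡ (v j))

  by-position : s ≤ lo ⊎ hi ≤ s → t ≤ lo ⊎ hi ≤ t → Σ n product ≡ + 0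
  by-position (inj₂ hi≤s) _ = Σ-zero n product (λ i _ → product-zero (suc i))
    where
    product-zero : ∀ j → Rvec s t j ℤ.* v j ≡ + 0
    product-zero j with j ℕ.≤? s
    ... | yes j≤s = R-zero j (Rvec-below j≤s)
    ... | no  j≰s = v-zero j (v-above (≤-<-trans hi≤s (≰⇒> j≰s)))
  by-position (inj₁ _) (inj₁ t≤lo) = Σ-zero n product (λ i _ → product-zero (suc i))
    where
    product-zero : ∀ j → Rvec s t j ℤ.* v j ≡ + 0
    product-zero j with j ℕ.≤? lo
    ... | yes j≤lo = v-zero j (v-below j≤lo)
    ... | no  j≰lo = R-zero j (Rvec-above (≤-<-trans t≤lo (≰⇒> j≰lo)))
  by-position (inj₁ s≤lo) (inj₂ hi≤t) =
    trans (Σ-cong n product (λ i → v (suc i)) (λ i _ → R-covers s≤lo hi≤t (suc i))) v-total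

updown : ℕ → ℕ → ℕ → RVec
updown x y z j = if between x y j then + 1 else if between y z j then -[1+ 0 ] else + 0

haar : ℕ → ℕ → RVec
haar lo d = updown lo (lo + d) (lo + d + d)

module _ (lo d : ℕ) where

  haar-below : ∀ {j} → j ≤ lo → haar lo d j ≡ + 0
  haar-below j≤lo
    rewrite between-below {hi = lo + d} j≤lo
          | between-below {hi = lo + d + d} (≤-trans j≤lo (m≤m+n lo d)) = refl

  haar-above : ∀ {j} → lo + d + d < j → haar lo d j ≡ + 0
  haar-above hi<j
    rewrite between-above {lo = lo} (≤-<-trans (m≤m+n (lo + d) d) hi<j)
          | between-above {lo = lo + d} hi<j = refl

  haar-up : ∀ {j} → lo < j → j ≤ lo + d → haar lo d j ≡ + 1
  haar-up lo<j j≤mid rewrite between-inside lo<j j≤mid = refl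

  haar-down : ∀ {j} → lo + d < j → j ≤ lo + d + d → haar lo d j ≡ -[1+ 0 ]
  haar-down mid<j j≤hi rewrite between-above {lo = lo} mid<j | between-inside mid<j j≤hi = refl

  haar-halves-cancel : Σ d (λ i → haar lo d (suc (lo + i))) ℤ.+ Σ d (λ i → haar lo d (suc (lo + (d + i))))
                       ≡ + 0
  haar-halves-cancel =
    trans (Σ-+ d _ _) (Σ-zero d _ (λ i i<d → cong₂ ℤ._+_ (up-half i i<d) (down-half i i<d)))
    where
    up-half : ∀ i → i < d → haar lo d (suc (lo + i)) ≡ + 1
    up-half i i<d = haar-up (s≤s (m≤m+n lo i)) (subst (_≤ lo + d) (+-suc lo i) (+-monoʳ-≤ lo i<d))

    down-half : ∀ i → i < d → haar lo d (suc (lo + (d + i))) ≡ -[1+ 0 ]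
    down-half i i<d = haar-down
      (s≤s (subst (lo + d ≤_) (+-assoc lo d i) (m≤m+n (lo + d) i)))
      (subst (_≤ lo + d + d) (trans (+-suc (lo + d) i) (cong suc (+-assoc lo d i)))
             (+-monoʳ-≤ (lo + d) i<d))

  padding-length : ∀ {n} → lo + d + d ≤ n → lo + (d + (d + (n ∸ (lo + d + d)))) ≡ n
  padding-length {n} hi≤n =
    trans (solve 3 (λ l e r → l :+ (e :+ (e :+ r)) := l :+ e :+ e :+ r) refl lo d (n ∸ (lo + d + d)))
          (m+[n∸m]≡n hi≤n)

  haar-total : ∀ {n} → lo + d + d ≤ n → total n (haar lo d) ≡ + 0
  haar-total {n} hi≤n = subst (λ m → Σ m f ≡ + 0) (padding-length hi≤n) (begin
    Σ (lo + (d + (d + r))) f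
      ≡⟨ Σ-split lo _ f ⟩
    Σ lo f ℤ.+ Σ (d + (d + r)) up
      ≡⟨ cong (λ x → Σ lo f ℤ.+ x) (Σ-split d (d + r) up) ⟩
    Σ lo f ℤ.+ (Σ d up ℤ.+ Σ (d + r) down)
      ≡⟨ cong (λ x → Σ lo f ℤ.+ (Σ d up ℤ.+ x)) (Σ-split d r down) ⟩
    Σ lo f ℤ.+ (Σ d up ℤ.+ (Σ d down ℤ.+ Σ r after))
      ≡⟨ cong₂ (λ x y → x ℤ.+ (Σ d up ℤ.+ (Σ d down ℤ.+ y)))
               (Σ-zero lo f (λ i i<lo → haar-below i<lo))
               (Σ-zero r after (λ i _ → haar-above (s≤s (beyond i)))) ⟩
    + 0 ℤ.+ (Σ d up ℤ.+ (Σ d down ℤ.+ + 0))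
      ≡⟨ trans (ℤP.+-identityˡ _) (cong (λ x → Σ d up ℤ.+ x) (ℤP.+-identityʳ _)) ⟩
    Σ d up ℤ.+ Σ d down
      ≡⟨ haar-halves-cancel ⟩
    + 0 ∎)
    where
    open ≡-Reasoning
    r : ℕ
    r = n ∸ (lo + d + d)
    f up down after : ℕ → ℤ
    f i     = haar lo d (suc i)
    up i    = f (lo + i)
    down i  = f (lo + (d + i))
    after i = f (lo + (d + (d + i)))

    beyond : ∀ i → lo + d + d ≤ lo + (d + (d + i))
    beyond i = subst (_≤ lo + (d + (d + i))) (sym (+-assoc lo d d))
                     (+-monoʳ-≤ lo (+-monoʳ-≤ d (m≤m+n d i)))

Bvec-as-haar : ∀ a k → Bvec a (suc k) ≡ haar (k * 2 ^ suc a) (2 ^ a)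
Bvec-as-haar a k = cong₃ updown lo-eq mid-eq hi-eq
  where
  cong₃ : ∀ (f : ℕ → ℕ → ℕ → RVec) {x x′ y y′ z z′} → x ≡ x′ → y ≡ y′ → z ≡ z′ → f x y z ≡ f x′ y′ z′
  cong₃ f refl refl refl = refl
  -- 2·(k+1) = 2 + 2k, so that the truncated subtractions compute
  twice-suc : 2 * suc k ≡ 2 + 2 * k
  twice-suc = *-suc 2 k
  lo-eq : (2 * suc k ∸ 2) * 2 ^ a ≡ k * 2 ^ suc a
  lo-eq = trans (cong (λ m → (m ∸ 2) * 2 ^ a) twice-suc)
                (solve 2 (λ k x → con 2 :* k :* x := k :* (con 2 :* x)) refl k (2 ^ a))
  mid-eq : (2 * suc k ∸ 1) * 2 ^ a ≡ k * 2 ^ suc a + 2 ^ a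
  mid-eq = trans (cong (λ m → (m ∸ 1) * 2 ^ a) twice-suc)
                 (solve 2 (λ k x → (con 1 :+ con 2 :* k) :* x := k :* (con 2 :* x) :+ x) refl k (2 ^ a))
  hi-eq : 2 * suc k * 2 ^ a ≡ k * 2 ^ suc a + 2 ^ a + 2 ^ a
  hi-eq = solve 2 (λ k x → con 2 :* (con 1 :+ k) :* x := k :* (con 2 :* x) :+ x :+ x) refl k (2 ^ a)

block-end : ∀ a k → k * 2 ^ suc a + 2 ^ a + 2 ^ a ≡ suc k * 2 ^ suc a
block-end a k = solve 2 (λ k x → k :* (con 2 :* x) :+ x :+ x := (con 1 :+ k) :* (con 2 :* x)) refl k (2 ^ a)

below : ℕ → ℕ → ℕ
below x c = if x <ᵇ c then 1 else 0

below-≤1 : ∀ x c → below x c ≤ 1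
below-≤1 x c with x <ᵇ c
... | true  = ≤-refl
... | false = z≤n

below-mono : ∀ x {c c′} → c ≤ c′ → below x c ≤ below x c′
below-mono x {c} {c′} c≤c′ with x <? c
... | yes x<c rewrite <ᵇ-true x<c | <ᵇ-true (<-≤-trans x<c c≤c′) = ≤-refl
... | no  x≮c rewrite <ᵇ-false (≮⇒≥ x≮c) = z≤n

below-jump : ∀ {lo hi x} → Inside lo hi x → suc (below x lo) ≤ below x hi
below-jump (lo<x , x<hi) rewrite <ᵇ-false (<⇒≤ lo<x) | <ᵇ-true x<hi = ≤-refl

module Endpoints (s t : ℕ) where

  endpoints : ℕ → ℕ
  endpoints c = below s c + below t c

  endpoints-≤2 : ∀ c → endpoints c ≤ 2
  endpoints-≤2 c = +-mono-≤ (below-≤1 s c) (below-≤1 t c)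

  endpoints-mono : ∀ {lo hi} → lo ≤ hi → endpoints lo ≤ endpoints hi
  endpoints-mono lo≤hi = +-mono-≤ (below-mono s lo≤hi) (below-mono t lo≤hi)

  endpoints-jump : ∀ {lo hi} → lo ≤ hi → Inside lo hi s ⊎ Inside lo hi t →
                   suc (endpoints lo) ≤ endpoints hi
  endpoints-jump lo≤hi (inj₁ s∈) = +-mono-≤ (below-jump s∈) (below-mono t lo≤hi)
  endpoints-jump {lo} {hi} lo≤hi (inj₂ t∈) =
    subst (_≤ endpoints hi) (+-suc (below s lo) (below t lo)) (+-mono-≤ (below-mono s lo≤hi) (below-jump t∈))

upTo-snoc : ∀ n → upTo (suc n) ≡ upTo n ++ (n ∷ [])
upTo-snoc n = sym (applyUpTo-∷ʳ (λ i → i) n)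

blocks : ℕ → ℕ → List RVec
blocks a K = map (λ k → Bvec a k) (map suc (upTo K))

level : ℕ → ℕ → List RVec
level p a = blocks a (2 ^ (p ∸ a ∸ 1))

-- count vs = number of vectors in vs with nonzero inner product against R_{s,t}
-- in ℝ^n; for n = 2^p, count (family p) is exactly countNonzero p s t.
module Counting (n s t : ℕ) where

  open Endpoints s t

  Nonzero : RVec → Set
  Nonzero v = ¬ (dot n (Rvec s t) v ≡ + 0)

  nonzero? : Decidable Nonzero
  nonzero? v = ¬? (dot n (Rvec s t) v ℤ.≟ + 0)

  count : List RVec → ℕ
  count vs = length (filter nonzero? vs)

  count-++ : ∀ us vs → count (us ++ vs) ≡ count us + count vs
  count-++ us vs = trans (cong length (filter-++ nonzero? us vs)) (length-++ (filter nonzero? us))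

  block-cut : ∀ lo d → lo + d + d ≤ n → Nonzero (haar lo d) →
              Inside lo (lo + d + d) s ⊎ Inside lo (lo + d + d) t
  block-cut lo d hi≤n nz with inside? lo (lo + d + d) s | inside? lo (lo + d + d) t
  ... | yes s∈ | _     = inj₁ s∈
  ... | no  _  | yes t∈ = inj₂ t∈
  ... | no  s∉ | no  t∉ = contradiction
    (interval-orthogonal n s t lo (lo + d + d) (haar lo d)
       (haar-below lo d) (haar-above lo d) (haar-total lo d hi≤n) s∉ t∉) nz

  count-append : ∀ us v {lo hi} → lo ≤ hi → (Nonzero v → Inside lo hi s ⊎ Inside lo hi t) →
                 count us ≤ endpoints lo → count (us ++ v ∷ []) ≤ endpoints hi
  count-append us v lo≤hi cut bound rewrite count-++ us (v ∷ []) with nonzero? v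
  ... | yes nz rewrite filter-accept nonzero? {xs = []} nz =
    ≤-trans (≤-reflexive (+-comm (count us) 1)) (≤-trans (s≤s bound) (endpoints-jump lo≤hi (cut nz)))
  ... | no  dot≡0 rewrite filter-reject nonzero? {xs = []} dot≡0 =
    ≤-trans (≤-reflexive (+-identityʳ (count us))) (≤-trans bound (endpoints-mono lo≤hi))

  blocks-count : ∀ a K → K * 2 ^ suc a ≤ n → count (blocks a K) ≤ endpoints (K * 2 ^ suc a)
  blocks-count a zero    _    = z≤n
  blocks-count a (suc K) K≤n = subst (λ vs → count vs ≤ endpoints (suc K * 2 ^ suc a)) (sym blocks-snoc)
    (count-append (blocks a K) (Bvec a (suc K)) (m≤n+m _ (2 ^ suc a)) cut
                  (blocks-count a K (≤-trans (m≤n+m _ (2 ^ suc a)) K≤n)))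
    where
    lo : ℕ
    lo = K * 2 ^ suc a
    blocks-snoc : blocks a (suc K) ≡ blocks a K ++ Bvec a (suc K) ∷ []
    blocks-snoc = trans (cong (λ ks → map (λ k → Bvec a k) (map suc ks)) (upTo-snoc K))
                  (trans (cong (map (λ k → Bvec a k)) (map-++ suc (upTo K) (K ∷ [])))
                         (map-++ (λ k → Bvec a k) (map suc (upTo K)) (suc K ∷ [])))
    cut : Nonzero (Bvec a (suc K)) → Inside lo (suc K * 2 ^ suc a) s ⊎ Inside lo (suc K * 2 ^ suc a) t
    cut nz = subst (λ hi → Inside lo hi s ⊎ Inside lo hi t) (block-end a K)
      (block-cut lo (2 ^ a) (subst (_≤ n) (sym (block-end a K)) K≤n)
                 (subst Nonzero (Bvec-as-haar a K) nz))

  level-count : ∀ p a → a < p → 2 ^ p ≤ n → count (level p a) ≤ 2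
  level-count p a a<p 2^p≤n =
    ≤-trans (blocks-count a (2 ^ (p ∸ a ∸ 1)) (subst (_≤ n) (sym level-length) 2^p≤n))
            (endpoints-≤2 (2 ^ (p ∸ a ∸ 1) * 2 ^ suc a))
    where
    exponents : p ∸ a ∸ 1 + suc a ≡ p
    exponents = trans (cong (_+ suc a) (trans (∸-+-assoc p a 1) (cong (p ∸_) (+-comm a 1))))
                      (m∸n+n≡m a<p)
    level-length : 2 ^ (p ∸ a ∸ 1) * 2 ^ suc a ≡ 2 ^ p
    level-length = trans (sym (^-distribˡ-+-* 2 (p ∸ a ∸ 1) (suc a))) (cong (2 ^_) exponents)

  -- the top level a = p − 1 is the single vector B^(p−1)_1
  top-level-count : ∀ q → count (level (suc q) q) ≤ 1
  top-level-count q =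
    ≤-trans (length-filter nonzero? (level (suc q) q))
            (≤-reflexive (cong (λ e → length (blocks q (2 ^ e))) (cong (_∸ 1) (m+n∸n≡m 1 q))))

  count-concatMap : ∀ (f : ℕ → List RVec) c xs → (∀ x → x ∈ xs → count (f x) ≤ c) →
                    count (concatMap f xs) ≤ length xs * c
  count-concatMap f c []       _     = z≤n
  count-concatMap f c (x ∷ xs) bound =
    subst (_≤ c + length xs * c) (sym (count-++ (f x) (concatMap f xs)))
      (+-mono-≤ (bound x (here refl)) (count-concatMap f c xs (λ y y∈ → bound y (there y∈))))

  count-family : ∀ q → count (family (suc q)) ≡
                 count (concatMap (level (suc q)) (upTo q)) + count (level (suc q) q) + count (ones ∷ [])
  count-family q = begin
    count (family (suc q))
      ≡⟨ count-++ (concatMap (level (suc q)) (upTo (suc q))) (ones ∷ []) ⟩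
    count (concatMap (level (suc q)) (upTo (suc q))) + count (ones ∷ [])
      ≡⟨ cong (λ vs → count vs + count (ones ∷ [])) levels-split ⟩
    count (concatMap (level (suc q)) (upTo q) ++ level (suc q) q) + count (ones ∷ [])
      ≡⟨ cong (_+ count (ones ∷ [])) (count-++ (concatMap (level (suc q)) (upTo q)) (level (suc q) q)) ⟩
    count (concatMap (level (suc q)) (upTo q)) + count (level (suc q) q) + count (ones ∷ []) ∎
    where
    open ≡-Reasoning
    levels-split : concatMap (level (suc q)) (upTo (suc q))
                   ≡ concatMap (level (suc q)) (upTo q) ++ level (suc q) q
    levels-split = trans (cong (concatMap (level (suc q))) (upTo-snoc q))
                  (trans (concatMap-++ (level (suc q)) (upTo q) (q ∷ []))
                         (cong (concatMap (level (suc q)) (upTo q) ++_) (++-identityʳ (level (suc q) q))))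

lemma1 : (p : ℕ) → 1 ≤ p → (s t : ℕ) → s < t → countNonzero p s t ≤ 2 * p
lemma1 zero    () s t _
lemma1 (suc q) _  s t _ = begin
  count (family (suc q))
    ≡⟨ count-family q ⟩
  count (concatMap (level (suc q)) (upTo q)) + count (level (suc q) q) + count (ones ∷ [])
    ≤⟨ +-mono-≤ (+-mono-≤ lower-levels (top-level-count q)) (length-filter nonzero? (ones ∷ [])) ⟩
  q * 2 + 1 + 1
    ≡⟨ solve 1 (λ q → q :* con 2 :+ con 1 :+ con 1 := con 2 :* (con 1 :+ q)) refl q ⟩
  2 * suc q ∎
  where
  open Counting (2 ^ suc q) s t
  open ≤-Reasoning
  lower-levels : count (concatMap (level (suc q)) (upTo q)) ≤ q * 2
  lower-levels = subst (λ m → count (concatMap (level (suc q)) (upTo q)) ≤ m * 2) (length-upTo q)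
    (count-concatMap (level (suc q)) 2 (upTo q)
      (λ a a∈ → level-count (suc q) a (≤-trans (∈-upTo⁻ a∈) (n≤1+n q)) ≤-refl))
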